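{- Let $T$ be a complete theory, let $f$ and $g$ be $\emptyset$-definable functions (mapping finite tuples to finite tuples) and let $a,a',b,b'$ be finite tuples with $\mathrm{tp}(a;b)\rightsquigarrow\mathrm{tp}(a';b')$. Then $\mathrm{tp}(f(a);g(b))\rightsquigarrow\mathrm{tp}(f(a');g(b'))$.
   Context: Work in a sufficiently saturated model of the complete theory $T$. For tuples $a,b$, $\mathrm{tp}(a;b)$ denotes the complete type of $(a,b)$ over $\emptyset$ with its variables partitioned as $x;y$ corresponding to $a;b$. For complete types $p(x;y)$, $q(x;y)$ over $\emptyset$, write $p(x;y)\rightsquigarrow q(x;y)$ if there are a tuple $b$ and an indiscernible sequence $(a_i)_{i\in\mathbb N}$ with $\models p(a_i,b)$ for all $i>0$ and $\models q(a_0,b)$. -}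

module Defs where

open import Data.Nat using (ℕ; zero; suc; _+_; _*_; _<_)
open import Data.Fin using (Fin) renaming (_<_ to _<ᶠ_)
open import Data.Vec using (Vec; []; _∷_; lookup; _++_; concat; tabulate)
open import Data.Product using (Σ; _×_; _,_)
open import Data.Empty using (⊥)
open import Relation.Binary.PropositionalEquality using (_≡_)
open import Function.Bundles using (_⇔_)

record Signature : Set₁ where
  field
    FunSym : ℕ → Set   -- function symbols of each arity (constants: arity 0)
    RelSym : ℕ → Set

module _ (L : Signature) where
  open Signature L

  data Term (k : ℕ) : Set where
    var : Fin k → Term k
    app : ∀ {n} → FunSym n → Vec (Term k) n → Term k

  -- formulas in k free variables (no parameters: ∅-formulas)
  data Formula (k : ℕ) : Set where
    ⊥'   : Formula k
    _≐_  : Term k → Term k → Formula k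
    rel  : ∀ {n} → RelSym n → Vec (Term k) n → Formula k
    ¬'_  : Formula k → Formula k
    _∧'_ : Formula k → Formula k → Formula k
    ∃'_  : Formula (suc k) → Formula k

  record Structure : Set₁ where
    field
      Carrier : Set
      funᴹ    : ∀ {n} → FunSym n → Vec Carrier n → Carrier
      relᴹ    : ∀ {n} → RelSym n → Vec Carrier n → Set

module _ {L : Signature} (M : Structure L) where
  open Signature L
  open Structure M

  mutual
    eval : ∀ {k} → Vec Carrier k → Term L k → Carrier
    eval ρ (var i)    = lookup ρ i
    eval ρ (app f ts) = funᴹ f (evals ρ ts)

    evals : ∀ {k n} → Vec Carrier k → Vec (Term L k) n → Vec Carrier n
    evals ρ []       = []
    evals ρ (t ∷ ts) = eval ρ t ∷ evals ρ ts

  Sat : ∀ {k} → Formula L k → Vec Carrier k → Set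
  Sat ⊥'        ρ = ⊥
  Sat (s ≐ t)   ρ = eval ρ s ≡ eval ρ t
  Sat (rel R ts) ρ = relᴹ R (evals ρ ts)
  Sat (¬' φ)    ρ = Sat φ ρ → ⊥
  Sat (φ ∧' ψ)  ρ = Sat φ ρ × Sat ψ ρ
  Sat (∃' φ)    ρ = Σ Carrier λ c → Sat φ (c ∷ ρ)

  SameTp : ∀ {n m} → Vec Carrier n → Vec Carrier m
                   → Vec Carrier n → Vec Carrier m → Set
  SameTp {n} {m} c d a b = (φ : Formula L (n + m)) → Sat φ (c ++ d) ⇔ Sat φ (a ++ b)

  StrictlyIncreasing : ∀ {k} → (Fin k → ℕ) → Set
  StrictlyIncreasing {k} i = ∀ {p q : Fin k} → p <ᶠ q → i p < i q

  Indiscernible : ∀ {n} → (ℕ → Vec Carrier n) → Set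
  Indiscernible {n} s =
    ∀ (k : ℕ) (i j : Fin k → ℕ) → StrictlyIncreasing i → StrictlyIncreasing j →
    (φ : Formula L (k * n)) →
    Sat φ (concat (tabulate (λ p → s (i p)))) ⇔ Sat φ (concat (tabulate (λ p → s (j p))))

  Leadsto : ∀ {n m} → Vec Carrier n → Vec Carrier m
                    → Vec Carrier n → Vec Carrier m → Set
  Leadsto {n} {m} a b a' b' =
    Σ (Vec Carrier m) λ e → Σ (ℕ → Vec Carrier n) λ s →
      Indiscernible s × ((i : ℕ) → SameTp (s (suc i)) e a b) × SameTp (s zero) e a' b'

  record DefinableFun (n m : ℕ) : Set₁ where
    field
      fun     : Vec Carrier n → Vec Carrier m
      graph   : Formula L (n + m)
      defines : ∀ (x : Vec Carrier n) (y : Vec Carrier m) → (fun x ≡ y) ⇔ Sat graph (x ++ y)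
  open DefinableFun public

-- A formula about f(x) pulls back along the graph of f to the formula
-- ∃y (graph(x, y) ∧ φ(y)) about x. Hence ∅-definable maps send tuples of
-- equal type to tuples of equal type, and, applied blockwise, send
-- indiscernible sequences to indiscernible sequences. Applying f to the
-- sequence witnessing tp(a;b) ⇝ tp(a';b') and g to its parameter gives the
-- sequence witnessing tp(f(a);g(b)) ⇝ tp(f(a');g(b')).
module Submission where

open import Defs
open import Data.Nat using (ℕ; zero; suc; _+_; _*_)
open import Data.Fin using (Fin; _↑ˡ_; _↑ʳ_; splitAt) renaming (zero to fzero; suc to fsuc)
open import Data.Vec using (Vec; []; _∷_; lookup; _++_; concat; tabulate)
import Data.Vec as Vec
open import Data.Vec.Properties using (lookup-++ˡ; lookup-++ʳ; lookup-splitAt; ++-injective)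
open import Data.Sum using (inj₁; inj₂; [_,_]′)
open import Data.Product using (Σ; _×_; _,_; uncurry)
open import Data.Product.Function.NonDependent.Propositional using (_×-⇔_)
open import Data.Product.Function.Dependent.Propositional using (Σ-⇔)
open import Function using (_∘_)
open import Function.Bundles using (_⇔_; mk⇔; Equivalence)
open import Function.Construct.Identity using (⇔-id; ↠-id)
open import Function.Construct.Symmetry using (⇔-sym)
open import Function.Related.Propositional using (module EquationalReasoning)
open import Function.Related.TypeIsomorphisms using (¬-cong-⇔)
open import Relation.Binary.PropositionalEquality
  using (_≡_; refl; sym; trans; cong; cong₂; subst; _≗_)

open Equivalence using (to; from)

_⊕_ : ∀ {a b k} → (Fin a → Fin k) → (Fin b → Fin k) → Fin (a + b) → Fin k
_⊕_ {a} r s = [ r , s ]′ ∘ splitAt a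

lift : ∀ {k k′} → (Fin k → Fin k′) → Fin (suc k) → Fin (suc k′)
lift r fzero    = fzero
lift r (fsuc i) = fsuc (r i)

module Syntax {L : Signature} where

  mutual
    renameᵗ : ∀ {k k′} → (Fin k → Fin k′) → Term L k → Term L k′
    renameᵗ r (var i)    = var (r i)
    renameᵗ r (app f ts) = app f (renameᵗˢ r ts)

    renameᵗˢ : ∀ {k k′ n} → (Fin k → Fin k′) → Vec (Term L k) n → Vec (Term L k′) n
    renameᵗˢ r []       = []
    renameᵗˢ r (t ∷ ts) = renameᵗ r t ∷ renameᵗˢ r ts

  rename : ∀ {k k′} → (Fin k → Fin k′) → Formula L k → Formula L k′
  rename r ⊥'         = ⊥'
  rename r (s ≐ t)    = renameᵗ r s ≐ renameᵗ r t
  rename r (rel R ts) = rel R (renameᵗˢ r ts)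
  rename r (¬' φ)     = ¬' rename r φ
  rename r (φ ∧' ψ)   = rename r φ ∧' rename r ψ
  rename r (∃' φ)     = ∃' rename (lift r) φ

  ∃ⁿ : ∀ j {k} → Formula L (j + k) → Formula L k
  ∃ⁿ zero    φ = φ
  ∃ⁿ (suc j) φ = ∃ⁿ j (∃' φ)

open Syntax

module Semantics {L : Signature} (M : Structure L) where
  open Structure M renaming (Carrier to C)

  record Reindexing {k k′} (r : Fin k → Fin k′) (ρ : Vec C k′) (σ : Vec C k) : Set where
    constructor reindexing
    field lookup-reindex : lookup σ ≗ lookup ρ ∘ r
  open Reindexing

  reindex-++ˡ : ∀ {m n} (xs : Vec C m) (ys : Vec C n) → Reindexing (_↑ˡ n) (xs ++ ys) xs
  reindex-++ˡ xs ys = reindexing λ i → sym (lookup-++ˡ xs ys i)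

  reindex-++ʳ : ∀ {m n} (xs : Vec C m) (ys : Vec C n) → Reindexing (m ↑ʳ_) (xs ++ ys) ys
  reindex-++ʳ xs ys = reindexing λ i → sym (lookup-++ʳ xs ys i)

  reindex-∘ : ∀ {a b c} {σ : Vec C a} {ρ : Vec C b} {τ : Vec C c} {r s} →
              Reindexing r ρ σ → Reindexing s τ ρ → Reindexing (s ∘ r) τ σ
  reindex-∘ {r = r} (reindexing σ≗) (reindexing ρ≗) = reindexing λ i → trans (σ≗ i) (ρ≗ (r i))

  reindex-⊕ : ∀ {a b k} {x : Vec C a} {y : Vec C b} {ρ : Vec C k} {r s} →
              Reindexing r ρ x → Reindexing s ρ y → Reindexing (r ⊕ s) ρ (x ++ y)
  reindex-⊕ {a} {x = x} {y} {ρ} {r} {s} (reindexing x≗) (reindexing y≗) = reindexing xy≗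
    where
    xy≗ : lookup (x ++ y) ≗ lookup ρ ∘ (r ⊕ s)
    xy≗ i rewrite lookup-splitAt a x y i with splitAt a i
    ... | inj₁ p = x≗ p
    ... | inj₂ q = y≗ q

  reindex-lift : ∀ {k k′} {r : Fin k → Fin k′} {ρ σ} c →
                 Reindexing r ρ σ → Reindexing (lift r) (c ∷ ρ) (c ∷ σ)
  reindex-lift {r = r} {ρ} {σ} c (reindexing σ≗) = reindexing cσ≗
    where
    cσ≗ : lookup (c ∷ σ) ≗ lookup (c ∷ ρ) ∘ lift r
    cσ≗ fzero    = refl
    cσ≗ (fsuc i) = σ≗ i

  mutual
    eval-renameᵗ : ∀ {k k′} {r : Fin k → Fin k′} {ρ σ} → Reindexing r ρ σ →
                   ∀ t → eval M ρ (renameᵗ r t) ≡ eval M σ t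
    eval-renameᵗ σ≗ (var i)    = sym (lookup-reindex σ≗ i)
    eval-renameᵗ σ≗ (app f ts) = cong (funᴹ f) (evals-renameᵗˢ σ≗ ts)

    evals-renameᵗˢ : ∀ {k k′ n} {r : Fin k → Fin k′} {ρ σ} → Reindexing r ρ σ →
                     (ts : Vec (Term L k) n) → evals M ρ (renameᵗˢ r ts) ≡ evals M σ ts
    evals-renameᵗˢ σ≗ []       = refl
    evals-renameᵗˢ σ≗ (t ∷ ts) = cong₂ _∷_ (eval-renameᵗ σ≗ t) (evals-renameᵗˢ σ≗ ts)

  Sat-rename : ∀ {k k′} {r : Fin k → Fin k′} {ρ σ} → Reindexing r ρ σ →
               (φ : Formula L k) → Sat M (rename r φ) ρ ⇔ Sat M φ σ
  Sat-rename σ≗ ⊥'         = ⇔-id _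
  Sat-rename σ≗ (s ≐ t)    rewrite eval-renameᵗ σ≗ s | eval-renameᵗ σ≗ t = ⇔-id _
  Sat-rename σ≗ (rel R ts) rewrite evals-renameᵗˢ σ≗ ts = ⇔-id _
  Sat-rename σ≗ (¬' φ)     = ¬-cong-⇔ (Sat-rename σ≗ φ)
  Sat-rename σ≗ (φ ∧' ψ)   = Sat-rename σ≗ φ ×-⇔ Sat-rename σ≗ ψ
  Sat-rename σ≗ (∃' φ)     = Σ-⇔ (↠-id _) λ {c} → Sat-rename (reindex-lift c σ≗) φ

  Sat-∃ⁿ : ∀ j {k} (φ : Formula L (j + k)) (ρ : Vec C k) →
           Sat M (∃ⁿ j φ) ρ ⇔ Σ (Vec C j) λ ys → Sat M φ (ys ++ ρ)
  Sat-∃ⁿ zero    φ ρ = mk⇔ ([] ,_) λ { ([] , s) → s }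
  Sat-∃ⁿ (suc j) φ ρ = mk⇔ (λ s → let ys , c , t = to (Sat-∃ⁿ j (∃' φ) ρ) s in c ∷ ys , t)
                          (λ { (c ∷ ys , t) → from (Sat-∃ⁿ j (∃' φ) ρ) (ys , c , t) })

  SameType : ∀ {k} → Vec C k → Vec C k → Set
  SameType {k} ρ σ = (φ : Formula L k) → Sat M φ ρ ⇔ Sat M φ σ

  record Defines {k j} (Γ : Formula L (k + j)) (x : Vec C k) (y : Vec C j) : Set where
    constructor defines-at
    field Sat⇔≡ : (ys : Vec C j) → Sat M Γ (x ++ ys) ⇔ (ys ≡ y)

  -- ∃ys (Γ(x, ys) ∧ φ(ys)); the bound ys come first because ∃ⁿ binds a prefix.
  pullbackBody : ∀ {k j} → Formula L (k + j) → Formula L j → Formula L (j + k)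
  pullbackBody {k} {j} Γ φ = rename ((j ↑ʳ_) ⊕ (_↑ˡ k)) Γ ∧' rename (_↑ˡ k) φ

  pullback : ∀ {k j} → Formula L (k + j) → Formula L j → Formula L k
  pullback {j = j} Γ φ = ∃ⁿ j (pullbackBody Γ φ)

  Sat-pullback : ∀ {k j} {Γ : Formula L (k + j)} {x : Vec C k} {y : Vec C j} → Defines Γ x y →
                 (φ : Formula L j) → Sat M (pullback Γ φ) x ⇔ Sat M φ y
  Sat-pullback {k} {j} {Γ} {x} {y} (defines-at Γ-at) φ =
    mk⇔ (λ s → let ys , γ , ψ = to Sat-body s in
                subst (Sat M φ) (to (Γ-at ys) (to (Sat-graph ys) γ)) (to (Sat-φ ys) ψ))
        (λ ψ → from Sat-body (y , from (Sat-graph y) (from (Γ-at y) refl) , from (Sat-φ y) ψ))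
    where
    Sat-body : Sat M (pullback Γ φ) x ⇔ Σ (Vec C j) λ ys → Sat M (pullbackBody Γ φ) (ys ++ x)
    Sat-body = Sat-∃ⁿ j (pullbackBody Γ φ) x

    Sat-graph : ∀ ys → Sat M (rename ((j ↑ʳ_) ⊕ (_↑ˡ k)) Γ) (ys ++ x) ⇔ Sat M Γ (x ++ ys)
    Sat-graph ys = Sat-rename (reindex-⊕ (reindex-++ʳ ys x) (reindex-++ˡ ys x)) Γ

    Sat-φ : ∀ ys → Sat M (rename (_↑ˡ k) φ) (ys ++ x) ⇔ Sat M φ ys
    Sat-φ ys = Sat-rename (reindex-++ˡ ys x) φ

  SameType-image : ∀ {k j} {Γ : Formula L (k + j)} {x x′ : Vec C k} {y y′ : Vec C j} →
                   Defines Γ x y → Defines Γ x′ y′ → SameType x x′ → SameType y y′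
  SameType-image {Γ = Γ} {x} {x′} {y} {y′} Γ-x Γ-x′ x≡x′ φ = begin
    Sat M φ y                    ∼⟨ ⇔-sym (Sat-pullback Γ-x φ) ⟩
    Sat M (pullback Γ φ) x       ∼⟨ x≡x′ (pullback Γ φ) ⟩
    Sat M (pullback Γ φ) x′      ∼⟨ Sat-pullback Γ-x′ φ ⟩
    Sat M φ y′                   ∎
    where open EquationalReasoning

  Defines-graph : ∀ {n n₁} (f : DefinableFun M n n₁) x → Defines (graph f) x (fun f x)
  Defines-graph f x = defines-at λ ys → mk⇔ (sym ∘ from (defines f x ys)) (to (defines f x ys) ∘ sym)

  -- Γ(x₁, y₁) ∧ Δ(x₂, y₂) in the variables x₁ x₂ y₁ y₂.
  pairing : ∀ {k₁ j₁ k₂ j₂} → Formula L (k₁ + j₁) → Formula L (k₂ + j₂) →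
            Formula L ((k₁ + k₂) + (j₁ + j₂))
  pairing {k₁} {j₁} {k₂} {j₂} Γ Δ =
    rename ((λ p → (p ↑ˡ k₂) ↑ˡ (j₁ + j₂)) ⊕ (λ q → (k₁ + k₂) ↑ʳ (q ↑ˡ j₂))) Γ ∧'
    rename ((λ p → (k₁ ↑ʳ p) ↑ˡ (j₁ + j₂)) ⊕ (λ q → (k₁ + k₂) ↑ʳ (j₁ ↑ʳ q))) Δ

  Sat-pairing : ∀ {k₁ j₁ k₂ j₂} (Γ : Formula L (k₁ + j₁)) (Δ : Formula L (k₂ + j₂))
                (x₁ : Vec C k₁) (y₁ : Vec C j₁) (x₂ : Vec C k₂) (y₂ : Vec C j₂) →
                Sat M (pairing {k₁} {j₁} {k₂} {j₂} Γ Δ) ((x₁ ++ x₂) ++ (y₁ ++ y₂)) ⇔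
                (Sat M Γ (x₁ ++ y₁) × Sat M Δ (x₂ ++ y₂))
  Sat-pairing {k₁} {j₁} {k₂} {j₂} Γ Δ x₁ y₁ x₂ y₂ =
    Sat-rename (reindex-⊕ (reindex-∘ (reindex-++ˡ x₁ x₂) (reindex-++ˡ x y))
                          (reindex-∘ (reindex-++ˡ y₁ y₂) (reindex-++ʳ x y))) Γ
    ×-⇔
    Sat-rename (reindex-⊕ (reindex-∘ (reindex-++ʳ x₁ x₂) (reindex-++ˡ x y))
                          (reindex-∘ (reindex-++ʳ y₁ y₂) (reindex-++ʳ x y))) Δ
    where
    x : Vec C (k₁ + k₂)
    x = x₁ ++ x₂
    y : Vec C (j₁ + j₂)
    y = y₁ ++ y₂

  Defines-pairing : ∀ {k₁ j₁ k₂ j₂} {Γ : Formula L (k₁ + j₁)} {Δ : Formula L (k₂ + j₂)}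
                    {x₁ : Vec C k₁} {y₁ : Vec C j₁} {x₂ : Vec C k₂} {y₂ : Vec C j₂} →
                    Defines Γ x₁ y₁ → Defines Δ x₂ y₂ →
                    Defines (pairing {k₁} {j₁} {k₂} {j₂} Γ Δ) (x₁ ++ x₂) (y₁ ++ y₂)
  Defines-pairing {k₁} {j₁} {k₂} {j₂} {Γ} {Δ} {x₁} {y₁} {x₂} {y₂}
                  (defines-at Γ-at) (defines-at Δ-at) =
    defines-at λ ys → at-split (Vec.splitAt j₁ {j₂} ys)
    where
    at-split : ∀ {ys} → Σ (Vec C j₁) (λ ys₁ → Σ (Vec C j₂) λ ys₂ → ys ≡ ys₁ ++ ys₂) →
               Sat M (pairing {k₁} {j₁} {k₂} {j₂} Γ Δ) ((x₁ ++ x₂) ++ ys) ⇔ (ys ≡ y₁ ++ y₂)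
    at-split (ys₁ , ys₂ , refl) = begin
      Sat M (pairing {k₁} {j₁} {k₂} {j₂} Γ Δ) ((x₁ ++ x₂) ++ (ys₁ ++ ys₂))
        ∼⟨ Sat-pairing Γ Δ x₁ ys₁ x₂ ys₂ ⟩
      (Sat M Γ (x₁ ++ ys₁) × Sat M Δ (x₂ ++ ys₂))
        ∼⟨ Γ-at ys₁ ×-⇔ Δ-at ys₂ ⟩
      (ys₁ ≡ y₁ × ys₂ ≡ y₂)
        ∼⟨ mk⇔ (uncurry (cong₂ _++_)) (++-injective ys₁ y₁) ⟩
      ys₁ ++ ys₂ ≡ y₁ ++ y₂
        ∎
      where open EquationalReasoning

  graphⁿ : ∀ {n n₁} → DefinableFun M n n₁ → ∀ k → Formula L (k * n + k * n₁)
  graphⁿ f zero              = ¬' ⊥'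
  graphⁿ {n} {n₁} f (suc k) = pairing {n} {n₁} {k * n} {k * n₁} (graph f) (graphⁿ f k)

  Defines-graphⁿ : ∀ {n n₁} (f : DefinableFun M n n₁) k (h : Fin k → Vec C n) →
                   Defines (graphⁿ f k) (concat (tabulate h)) (concat (tabulate (fun f ∘ h)))
  Defines-graphⁿ f zero    h = defines-at λ { [] → mk⇔ (λ _ → refl) (λ _ ()) }
  Defines-graphⁿ f (suc k) h =
    Defines-pairing (Defines-graph f (h fzero)) (Defines-graphⁿ f k (h ∘ fsuc))

  Indiscernible-image : ∀ {n n₁} (f : DefinableFun M n n₁) {s : ℕ → Vec C n} →
                        Indiscernible M s → Indiscernible M (fun f ∘ s)
  Indiscernible-image f {s} s-indisc k i j i↑ j↑ =
    SameType-image (Defines-graphⁿ f k (s ∘ i)) (Defines-graphⁿ f k (s ∘ j)) (s-indisc k i j i↑ j↑)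

  SameTp-image : ∀ {n m n₁ m₁} (f : DefinableFun M n n₁) (g : DefinableFun M m m₁) {x z x′ z′} →
                 SameTp M x z x′ z′ → SameTp M (fun f x) (fun g z) (fun f x′) (fun g z′)
  SameTp-image f g =
    SameType-image (Defines-pairing (Defines-graph f _) (Defines-graph g _))
                   (Defines-pairing (Defines-graph f _) (Defines-graph g _))

open Semantics

corollary2p6 : {L : Signature} (M : Structure L) {n m n₁ m₁ : ℕ}
    (f : DefinableFun M n n₁) (g : DefinableFun M m m₁)
    (a a' : Vec (Structure.Carrier M) n) (b b' : Vec (Structure.Carrier M) m) →
    Leadsto M a b a' b' →
    Leadsto M (fun f a) (fun g b) (fun f a') (fun g b')
corollary2p6 M f g a a' b b' (e , s , s-indisc , s-tp , s₀-tp) =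
  fun g e , fun f ∘ s , Indiscernible-image M f {s} s-indisc ,
  (λ i → SameTp-image M f g (s-tp i)) , SameTp-image M f g s₀-tp
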